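{- Let $\mathcal{C}$ be a subgroup of $\mathcal{G}=\mathbb{Z}_2^{k_1}\times\mathbb{Z}_4^{k_2}\times Q_8^{k_3}$ such that $C=\Phi(\mathcal{C})$ is a binary Hadamard code, and let $\mathcal{A}$ be any subgroup of $\mathcal{C}$ containing $T(\mathcal{C})$, the subgroup of elements of $\mathcal{C}$ of order at most two. Then $\mathcal{A}$ is a normal subgroup of $\mathcal{C}$.
   Context: $Q_8=\langle \mathbf{a},\mathbf{b} : \mathbf{a}^4=\mathbf{a}^2\mathbf{b}^2=\mathbf{1},\ \mathbf{b}\mathbf{a}\mathbf{b}^{ -1}=\mathbf{a}^{ -1}\rangle$ is the quaternion group of order 8; $\mathcal{G}$ is written multiplicatively, with identity $\mathbf{e}$. The Gray map $\Phi:\mathcal{G}\to\mathbb{Z}_2^{k_1+2k_2+4k_3}$ acts componentwise: as the identity on $\mathbb{Z}_2$-components; on $\mathbb{Z}_4$-components by $0\mapsto 00$, $1\mapsto 01$, $2\mapsto 11$, $3\mapsto 10$; on $Q_8$-components by $\mathbf{1}\mapsto 0000$, $\mathbf{b}\mapsto 0110$, $\mathbf{a}\mapsto 0101$, $\mathbf{a}\mathbf{b}\mapsto 1100$, $\mathbf{a}^2\mapsto 1111$, $\mathbf{a}^2\mathbf{b}\mapsto 1001$, $\mathbf{a}^3\mapsto 1010$, $\mathbf{a}^3\mathbf{b}\mapsto 0011$. A binary Hadamard code of length $n$ is the set consisting of the rows of a normalized binary Hadamard matrix of order $n$ (a $\pm1$ Hadamard matrix with $+1\mapsto 0$, $-1\mapsto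 1$) together with their complements; it has $2n$ codewords and minimum distance $n/2$. Throughout, the length $n=k_1+2k_2+4k_3$ is $2^m$. -}

module Defs where

open import Data.Bool using (Bool; true; false; not; _xor_)
open import Data.Nat using (ℕ; zero; suc; _+_; _*_; _^_)
open import Data.Fin using (Fin; toℕ)
open import Data.Integer using (ℤ; +_; -[1+_]) renaming (_+_ to _+ℤ_; _*_ to _*ℤ_)
open import Data.Vec using (Vec; []; _∷_; zipWith; map; replicate; concat; _++_; tabulate)
open import Data.Product using (_×_; _,_; Σ; ∃)
open import Data.Sum using (_⊎_)
open import Relation.Binary.PropositionalEquality using (_≡_)
open import Relation.Nullary using (yes; no)

data Z4 : Set where
  z0 z1 z2 z3 : Z4

suc4 : Z4 → Z4
suc4 z0 = z1
suc4 z1 = z2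
suc4 z2 = z3
suc4 z3 = z0

_+4_ : Z4 → Z4 → Z4
z0 +4 y = y
z1 +4 y = suc4 y
z2 +4 y = suc4 (suc4 y)
z3 +4 y = suc4 (suc4 (suc4 y))

neg4 : Z4 → Z4
neg4 z0 = z0
neg4 z1 = z3
neg4 z2 = z2
neg4 z3 = z1

-- Q₈ = ⟨a,b : a⁴ = a²b² = 1, bab⁻¹ = a⁻¹⟩.
-- Every element is written uniquely as  q i j = a^i b^j  (i ∈ ℤ₄, j ∈ {0,1}).

data Q8 : Set where
  q : Z4 → Bool → Q8

-- a^i b^j · a^k b^l = a^(i + (-1)^j k) b^(j+l), with b² = a².
_·Q_ : Q8 → Q8 → Q8
q i false ·Q q k l     = q (i +4 k) l
q i true  ·Q q k false = q (i +4 neg4 k) true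
q i true  ·Q q k true  = q ((i +4 neg4 k) +4 z2) false

oneQ : Q8
oneQ = q z0 false

invQ : Q8 → Q8
invQ (q i false) = q (neg4 i) false
invQ (q i true)  = q (i +4 z2) true

G : ℕ → ℕ → ℕ → Set
G k₁ k₂ k₃ = Vec Bool k₁ × Vec Z4 k₂ × Vec Q8 k₃

_∙_ : ∀ {k₁ k₂ k₃} → G k₁ k₂ k₃ → G k₁ k₂ k₃ → G k₁ k₂ k₃
(x , y , z) ∙ (x' , y' , z') = zipWith _xor_ x x' , zipWith _+4_ y y' , zipWith _·Q_ z z'

e : ∀ {k₁ k₂ k₃} → G k₁ k₂ k₃
e = replicate _ false , replicate _ z0 , replicate _ oneQ

_⁻¹ : ∀ {k₁ k₂ k₃} → G k₁ k₂ k₃ → G k₁ k₂ k₃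
(x , y , z) ⁻¹ = x , map neg4 y , map invQ z

record IsSubgroup {k₁ k₂ k₃} (P : G k₁ k₂ k₃ → Set) : Set where
  field
    e∈   : P e
    ∙∈   : ∀ {x y} → P x → P y → P (x ∙ y)
    ⁻¹∈  : ∀ {x} → P x → P (x ⁻¹)

_⊆_ : ∀ {k₁ k₂ k₃} → (G k₁ k₂ k₃ → Set) → (G k₁ k₂ k₃ → Set) → Set
A ⊆ B = ∀ {x} → A x → B x

T : ∀ {k₁ k₂ k₃} → (G k₁ k₂ k₃ → Set) → G k₁ k₂ k₃ → Set
T C x = C x × (x ∙ x ≡ e)

IsNormalIn : ∀ {k₁ k₂ k₃} → (G k₁ k₂ k₃ → Set) → (G k₁ k₂ k₃ → Set) → Set
IsNormalIn A C = ∀ {a c} → A a → C c → A ((c ∙ a) ∙ (c ⁻¹))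

grayZ4 : Z4 → Vec Bool 2
grayZ4 z0 = false ∷ false ∷ []
grayZ4 z1 = false ∷ true ∷ []
grayZ4 z2 = true ∷ true ∷ []
grayZ4 z3 = true ∷ false ∷ []

grayQ8 : Q8 → Vec Bool 4
grayQ8 (q z0 false) = false ∷ false ∷ false ∷ false ∷ []
grayQ8 (q z0 true)  = false ∷ true  ∷ true  ∷ false ∷ []
grayQ8 (q z1 false) = false ∷ true  ∷ false ∷ true  ∷ []
grayQ8 (q z1 true)  = true  ∷ true  ∷ false ∷ false ∷ []
grayQ8 (q z2 false) = true  ∷ true  ∷ true  ∷ true  ∷ []
grayQ8 (q z2 true)  = true  ∷ false ∷ false ∷ true  ∷ []
grayQ8 (q z3 false) = true  ∷ false ∷ true  ∷ false ∷ []
grayQ8 (q z3 true)  = false ∷ false ∷ true  ∷ true  ∷ []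

len : ℕ → ℕ → ℕ → ℕ
len k₁ k₂ k₃ = k₁ + k₂ * 2 + k₃ * 4

Φ : ∀ {k₁ k₂ k₃} → G k₁ k₂ k₃ → Vec Bool (len k₁ k₂ k₃)
Φ (x , y , z) = (x ++ concat (map grayZ4 y)) ++ concat (map grayQ8 z)

sumFin : ∀ {n} → (Fin n → ℤ) → ℤ
sumFin {zero}  f = + 0
sumFin {suc n} f = f Fin.zero +ℤ sumFin (λ i → f (Fin.suc i))
  where import Data.Fin as Fin

IsSign : ℤ → Set
IsSign x = (x ≡ + 1) ⊎ (x ≡ -[1+ 0 ])

nδ : (n : ℕ) → Fin n → Fin n → ℤ
nδ n i j with i Fin.≟ j
  where import Data.Fin as Fin
... | yes _ = + n
... | no  _ = + 0

record IsNormalizedHadamard (n : ℕ) (H : Fin n → Fin n → ℤ) : Set where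
  field
    entries    : ∀ i j → IsSign (H i j)
    orthogonal : ∀ i j → sumFin (λ k → H i k *ℤ H j k) ≡ nδ n i j
    firstRow   : ∀ i j → toℕ i ≡ 0 → H i j ≡ + 1
    firstCol   : ∀ i j → toℕ j ≡ 0 → H i j ≡ + 1

toBit : ℤ → Bool
toBit (+ _)    = false
toBit -[1+ _ ] = true

row : ∀ {n} → (Fin n → Fin n → ℤ) → Fin n → Vec Bool n
row H i = tabulate (λ j → toBit (H i j))

IsBinaryHadamardCode : (n : ℕ) → (Vec Bool n → Set) → Set
IsBinaryHadamardCode n S =
  Σ (Fin n → Fin n → ℤ) λ H → IsNormalizedHadamard n H ×
    (∀ w → (S w → ∃ λ i → (w ≡ row H i) ⊎ (w ≡ map not (row H i))) ×
           ((∃ λ i → (w ≡ row H i) ⊎ (w ≡ map not (row H i))) → S w))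

ImageΦ : ∀ {k₁ k₂ k₃} → (G k₁ k₂ k₃ → Set) → Vec Bool (len k₁ k₂ k₃) → Set
ImageΦ C w = ∃ λ c → C c × (Φ c ≡ w)

-- In 𝒢 every commutator squares to the identity: ℤ₂ and ℤ₄ are abelian, and
-- the commutators of Q₈ lie in its centre {1, a²}. So for c ∈ 𝒞 and a ∈ 𝒜 the
-- commutator [c , a] lies in T(𝒞) ⊆ 𝒜, and c a c⁻¹ = [c , a] a ∈ 𝒜.
module Submission where

open import Defs
open import Data.Nat using (ℕ; _^_)
open import Data.Product using (∃; _,_)
open import Data.Bool using (Bool; true; false; _xor_)
open import Data.Bool.Properties using (xor-same; xor-assoc; xor-identityʳ)
open import Data.Vec using (Vec; []; _∷_; zipWith; map; replicate)
open import Data.Vec.Properties using (zipWith-assoc; zipWith-identityʳ)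
open import Relation.Binary.PropositionalEquality
  using (_≡_; refl; sym; cong; cong₂; subst; module ≡-Reasoning)

Z4-elim : (P : Z4 → Set) → P z0 → P z1 → P z2 → P z3 → ∀ x → P x
Z4-elim P p0 p1 p2 p3 z0 = p0
Z4-elim P p0 p1 p2 p3 z1 = p1
Z4-elim P p0 p1 p2 p3 z2 = p2
Z4-elim P p0 p1 p2 p3 z3 = p3

Q8-elim : (P : Q8 → Set) →
  P (q z0 false) → P (q z1 false) → P (q z2 false) → P (q z3 false) →
  P (q z0 true)  → P (q z1 true)  → P (q z2 true)  → P (q z3 true)  → ∀ x → P x
Q8-elim P p0 p1 p2 p3 b0 b1 b2 b3 (q i false) = Z4-elim (λ i → P (q i false)) p0 p1 p2 p3 i
Q8-elim P p0 p1 p2 p3 b0 b1 b2 b3 (q i true)  = Z4-elim (λ i → P (q i true))  b0 b1 b2 b3 i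

module Componentwise {A : Set} (_·_ : A → A → A) (inv : A → A) (ε : A) where

  cancelʳ : (∀ x y → (x · inv y) · y ≡ x) →
            ∀ {n} (xs ys : Vec A n) → zipWith _·_ (zipWith _·_ xs (map inv ys)) ys ≡ xs
  cancelʳ law []       []       = refl
  cancelʳ law (x ∷ xs) (y ∷ ys) = cong₂ _∷_ (law x y) (cancelʳ law xs ys)

  commutator-square : (∀ c a → let k = ((c · a) · inv c) · inv a in k · k ≡ ε) →
    ∀ {n} (cs as : Vec A n) →
    let ks = zipWith _·_ (zipWith _·_ (zipWith _·_ cs as) (map inv cs)) (map inv as)
    in zipWith _·_ ks ks ≡ replicate n ε
  commutator-square law []       []       = refl
  commutator-square law (c ∷ cs) (a ∷ as) = cong₂ _∷_ (law c a) (commutator-square law cs as)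

  zipWith-self : (∀ x → x · x ≡ ε) → ∀ {n} (xs : Vec A n) → zipWith _·_ xs xs ≡ replicate n ε
  zipWith-self law []       = refl
  zipWith-self law (x ∷ xs) = cong₂ _∷_ (law x) (zipWith-self law xs)

module Z2ᵛ = Componentwise _xor_ (λ x → x) false
module Z4ᵛ = Componentwise _+4_ neg4 z0
module Q8ᵛ = Componentwise _·Q_ invQ oneQ

xorᵛ-cancelʳ : ∀ {n} (xs ys : Vec Bool n) → zipWith _xor_ (zipWith _xor_ xs ys) ys ≡ xs
xorᵛ-cancelʳ {n} xs ys = begin
  zipWith _xor_ (zipWith _xor_ xs ys) ys  ≡⟨ zipWith-assoc xor-assoc xs ys ys ⟩
  zipWith _xor_ xs (zipWith _xor_ ys ys)  ≡⟨ cong (zipWith _xor_ xs) (Z2ᵛ.zipWith-self xor-same ys) ⟩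
  zipWith _xor_ xs (replicate n false)    ≡⟨ zipWith-identityʳ xor-identityʳ xs ⟩
  xs                                      ∎
  where open ≡-Reasoning

+4-neg4-cancelʳ : ∀ x y → (x +4 neg4 y) +4 y ≡ x
+4-neg4-cancelʳ = Z4-elim _ (Z4-elim _ refl refl refl refl) (Z4-elim _ refl refl refl refl)
                            (Z4-elim _ refl refl refl refl) (Z4-elim _ refl refl refl refl)

Z4-commutator≡z0 : ∀ c a → ((c +4 a) +4 neg4 c) +4 neg4 a ≡ z0
Z4-commutator≡z0 = Z4-elim _ (Z4-elim _ refl refl refl refl) (Z4-elim _ refl refl refl refl)
                             (Z4-elim _ refl refl refl refl) (Z4-elim _ refl refl refl refl)

Z4-commutator-square : ∀ c a → let k = ((c +4 a) +4 neg4 c) +4 neg4 a in k +4 k ≡ z0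
Z4-commutator-square c a = cong (λ k → k +4 k) (Z4-commutator≡z0 c a)

Q8-cancelʳ : ∀ x y → (x ·Q invQ y) ·Q y ≡ x
Q8-cancelʳ = Q8-elim _
  (Q8-elim _ refl refl refl refl refl refl refl refl)
  (Q8-elim _ refl refl refl refl refl refl refl refl)
  (Q8-elim _ refl refl refl refl refl refl refl refl)
  (Q8-elim _ refl refl refl refl refl refl refl refl)
  (Q8-elim _ refl refl refl refl refl refl refl refl)
  (Q8-elim _ refl refl refl refl refl refl refl refl)
  (Q8-elim _ refl refl refl refl refl refl refl refl)
  (Q8-elim _ refl refl refl refl refl refl refl refl)

-- Q₈ commutators lie in the centre {1, a²}, which has exponent 2.
Q8-commutator-square : ∀ c a → let k = ((c ·Q a) ·Q invQ c) ·Q invQ a in k ·Q k ≡ oneQ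
Q8-commutator-square = Q8-elim _
  (Q8-elim _ refl refl refl refl refl refl refl refl)
  (Q8-elim _ refl refl refl refl refl refl refl refl)
  (Q8-elim _ refl refl refl refl refl refl refl refl)
  (Q8-elim _ refl refl refl refl refl refl refl refl)
  (Q8-elim _ refl refl refl refl refl refl refl refl)
  (Q8-elim _ refl refl refl refl refl refl refl refl)
  (Q8-elim _ refl refl refl refl refl refl refl refl)
  (Q8-elim _ refl refl refl refl refl refl refl refl)

[_,_] : ∀ {k₁ k₂ k₃} → G k₁ k₂ k₃ → G k₁ k₂ k₃ → G k₁ k₂ k₃
[ c , a ] = ((c ∙ a) ∙ (c ⁻¹)) ∙ (a ⁻¹)

∙-⁻¹-cancelʳ : ∀ {k₁ k₂ k₃} (x y : G k₁ k₂ k₃) → (x ∙ (y ⁻¹)) ∙ y ≡ x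
∙-⁻¹-cancelʳ (x₁ , x₂ , x₃) (y₁ , y₂ , y₃) =
  cong₂ _,_ (xorᵛ-cancelʳ x₁ y₁)
    (cong₂ _,_ (Z4ᵛ.cancelʳ +4-neg4-cancelʳ x₂ y₂) (Q8ᵛ.cancelʳ Q8-cancelʳ x₃ y₃))

commutator-square : ∀ {k₁ k₂ k₃} (c a : G k₁ k₂ k₃) → [ c , a ] ∙ [ c , a ] ≡ e
commutator-square (c₁ , c₂ , c₃) (a₁ , a₂ , a₃) =
  cong₂ _,_ (Z2ᵛ.zipWith-self xor-same _)
    (cong₂ _,_ (Z4ᵛ.commutator-square Z4-commutator-square c₂ a₂)
               (Q8ᵛ.commutator-square Q8-commutator-square c₃ a₃))

conjugate≡commutator∙ : ∀ {k₁ k₂ k₃} (c a : G k₁ k₂ k₃) → (c ∙ a) ∙ (c ⁻¹) ≡ [ c , a ] ∙ a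
conjugate≡commutator∙ c a = sym (∙-⁻¹-cancelʳ ((c ∙ a) ∙ (c ⁻¹)) a)

commutator∈T : ∀ {k₁ k₂ k₃} {C : G k₁ k₂ k₃ → Set} → IsSubgroup C →
               ∀ {c a} → C c → C a → T C [ c , a ]
commutator∈T sC Cc Ca = ∙∈ (∙∈ (∙∈ Cc Ca) (⁻¹∈ Cc)) (⁻¹∈ Ca) , commutator-square _ _
  where open IsSubgroup sC

T⊆⇒normal : ∀ {k₁ k₂ k₃} {C A : G k₁ k₂ k₃ → Set} →
               IsSubgroup C → IsSubgroup A → A ⊆ C → T C ⊆ A → IsNormalIn A C
T⊆⇒normal {A = A} sC sA A⊆C T⊆A {a} {c} Aa Cc =
  subst A (sym (conjugate≡commutator∙ c a)) (∙∈ (T⊆A (commutator∈T sC Cc (A⊆C Aa))) Aa)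
  where open IsSubgroup sA

mainTheorem1 : (k₁ k₂ k₃ : ℕ) → (∃ λ m → len k₁ k₂ k₃ ≡ 2 ^ m) →
    (C A : G k₁ k₂ k₃ → Set) →
    IsSubgroup C → IsBinaryHadamardCode (len k₁ k₂ k₃) (ImageΦ C) →
    IsSubgroup A → A ⊆ C → T C ⊆ A →
    IsNormalIn A C
mainTheorem1 _ _ _ _ C A sC _ sA A⊆C T⊆A = T⊆⇒normal sC sA A⊆C T⊆A
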